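{- Let $(U,\mathcal{A})$ be a partial Steiner triple system and $R\subseteq U$. Then there is at most one subsystem of $(U,\mathcal{A})$ whose point set contains $R$ and whose order is at most $2|R|$.
   Context: A partial Steiner triple system is a pair $(U,\mathcal{A})$ with $\mathcal{A}$ a set of 3-subsets (blocks) of $U$ such that every pair of points lies in at most one block. A subsystem of $(U,\mathcal{A})$ is a pair $(S,\mathcal{T})$ with $S\subseteq U$, $\mathcal{T}\subseteq\mathcal{A}$, such that every pair of points of $S$ lies in exactly one block of $\mathcal{T}$; its order is $|S|$. -}

module Defs where

open import Data.Nat using (ℕ)
open import Data.Fin using (Fin)
open import Data.Fin.Subset using (Subset; _∈_; _⊆_; ∣_∣)
open import Data.Product using (_×_; ∃!)
open import Relation.Binary.PropositionalEquality using (_≡_; _≢_)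

-- A family of blocks on the point set Fin n: a (not necessarily decidable)
-- predicate on subsets of Fin n.
Family : ℕ → Set₁
Family n = Subset n → Set

record IsPSTS {n : ℕ} (𝒜 : Family n) : Set where
  field
    triple   : ∀ B → 𝒜 B → ∣ B ∣ ≡ 3
    pairOnce : ∀ (x y : Fin n) → x ≢ y → ∀ B B′ → 𝒜 B → 𝒜 B′ →
               x ∈ B → y ∈ B → x ∈ B′ → y ∈ B′ → B ≡ B′

record IsSubsystem {n : ℕ} (𝒜 : Family n) (S : Subset n) (𝒯 : Family n) : Set where
  field
    sub       : ∀ B → 𝒯 B → 𝒜 B
    inside    : ∀ B → 𝒯 B → B ⊆ S
    exactlyOne : ∀ (x y : Fin n) → x ∈ S → y ∈ S → x ≢ y →
                 ∃! _≡_ (λ B → 𝒯 B × x ∈ B × y ∈ B)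

-- The order of a subsystem (S , 𝒯) is ∣ S ∣.

module Submission where

-- Let (S , 𝒯) and (S′ , 𝒯′) be subsystems of a partial Steiner triple
-- system, and suppose some point z lies in S but not in S′.  For every
-- w ∈ S ∩ S′, the 𝒯-block through w and z has a third point t(w).  This t(w)
-- is not in S′: otherwise the 𝒯′-block through w and t(w) would, by the
-- pair condition, be the very same block, forcing z ∈ S′.  Moreover w ↦ t(w)
-- is injective, since the block through z and t(w) determines w as its
-- remaining point.  Hence S contains S ∩ S′, the point z, and |S ∩ S′| further
-- points t(w), so 2 |S ∩ S′| < |S|.  If both contain R and |S| ≤ 2 |R|, this is
-- impossible, so S ⊆ S′ and symmetrically S′ ⊆ S.  Finally, blocks of a
-- subsystem are blocks of every subsystem on a larger point set (again by
-- the pair condition), which identifies 𝒯 and 𝒯′.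

open import Defs
open import Data.Nat using (ℕ; zero; suc; _≤_; _<_; _+_; _*_; s≤s; z≤n)
open import Data.Nat.Properties
  using (suc-injective; 0≢1+n; +-suc; +-identityʳ; +-monoʳ-<; *-monoʳ-≤; <-irrefl; module ≤-Reasoning)
open import Data.Fin using (Fin; _≟_)
open import Data.Fin.Subset
  using (Subset; inside; outside; _∈_; _∉_; _⊆_; ∣_∣; _∩_; _─_; _-_; ⁅_⁆; Nonempty)
open import Data.Fin.Subset.Properties
  using ( _∈?_; nonempty?; Empty-unique; ∣⊥∣≡0; p─⊥≡p; p─q⊆p; p⊆q⇒∣p∣≤∣q∣; ⊆-antisym
        ; x∈p∩q⁺; x∈p∩q⁻; x∈p∧x∉q⇒x∈p─q; x∈p∧x≢y⇒x∈p-y; x∉⁅y⁆⇒x≢y)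
open import Data.Vec using ([]; _∷_; here; there)
open import Data.Product using (Σ; _×_; _,_; proj₁; proj₂)
open import Data.Empty using (⊥-elim)
open import Function.Bundles using (_⇔_; mk⇔)
open import Relation.Nullary using (yes; no)
open import Relation.Binary.PropositionalEquality using (_≡_; _≢_; refl; sym; trans; cong; subst)

∣p∣≡suc∣p-x∣ : ∀ {n} {x : Fin n} {p : Subset n} → x ∈ p → ∣ p ∣ ≡ suc ∣ p - x ∣
∣p∣≡suc∣p-x∣ {p = inside ∷ q} here      = cong suc (sym (cong ∣_∣ (p─⊥≡p q)))
∣p∣≡suc∣p-x∣ {p = inside ∷ q} (there m) = cong suc (∣p∣≡suc∣p-x∣ m)
∣p∣≡suc∣p-x∣ {p = outside ∷ q} (there m) = ∣p∣≡suc∣p-x∣ m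

x∈p─q⇒x∉q : ∀ {n} {x : Fin n} (p q : Subset n) → x ∈ p ─ q → x ∉ q
x∈p─q⇒x∉q (s ∷ p) (inside ∷ q)  (there m) (there x∈q) = x∈p─q⇒x∉q p q m x∈q
x∈p─q⇒x∉q (s ∷ p) (outside ∷ q) (there m) (there x∈q) = x∈p─q⇒x∉q p q m x∈q

x∈p-y⁻ : ∀ {n} {x y : Fin n} (p : Subset n) → x ∈ p - y → x ∈ p × x ≢ y
x∈p-y⁻ {y = y} p m = p─q⊆p p ⁅ y ⁆ m , x∉⁅y⁆⇒x≢y (x∈p─q⇒x∉q p ⁅ y ⁆ m)

∣p∣≡suc⇒nonempty : ∀ {n k} (p : Subset n) → ∣ p ∣ ≡ suc k → Nonempty p
∣p∣≡suc⇒nonempty {n} p ∣p∣≡suc with nonempty? p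
... | yes ne = ne
... | no ¬ne with () ← trans (sym ∣p∣≡suc) (trans (cong ∣_∣ (Empty-unique ¬ne)) (∣⊥∣≡0 n))

∣p∣≡1⇒unique : ∀ {n} {a b : Fin n} {p : Subset n} → ∣ p ∣ ≡ 1 → a ∈ p → b ∈ p → a ≡ b
∣p∣≡1⇒unique {a = a} {b} ∣p∣≡1 a∈p b∈p with a ≟ b
... | yes a≡b = a≡b
... | no  a≢b = ⊥-elim (0≢1+n (trans (sym ∣p-a∣≡0) (∣p∣≡suc∣p-x∣ b∈p-a)))
  where
  b∈p-a = x∈p∧x≢y⇒x∈p-y b∈p (λ b≡a → a≢b (sym b≡a))
  ∣p-a∣≡0 = suc-injective (trans (sym (∣p∣≡suc∣p-x∣ a∈p)) ∣p∣≡1)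

∣p∣≡∣p∩q∣+∣p─q∣ : ∀ {n} (p q : Subset n) → ∣ p ∣ ≡ ∣ p ∩ q ∣ + ∣ p ─ q ∣
∣p∣≡∣p∩q∣+∣p─q∣ []           []           = refl
∣p∣≡∣p∩q∣+∣p─q∣ (inside ∷ p)  (inside ∷ q)  = cong suc (∣p∣≡∣p∩q∣+∣p─q∣ p q)
∣p∣≡∣p∩q∣+∣p─q∣ (inside ∷ p)  (outside ∷ q) =
  trans (cong suc (∣p∣≡∣p∩q∣+∣p─q∣ p q)) (sym (+-suc ∣ p ∩ q ∣ ∣ p ─ q ∣))
∣p∣≡∣p∩q∣+∣p─q∣ (outside ∷ p) (inside ∷ q)  = ∣p∣≡∣p∩q∣+∣p─q∣ p q
∣p∣≡∣p∩q∣+∣p─q∣ (outside ∷ p) (outside ∷ q) = ∣p∣≡∣p∩q∣+∣p─q∣ p q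

injection⇒∣A∣≤∣B∣ :
  ∀ {n} k (A B : Subset n) → ∣ A ∣ ≡ k →
  (f : ∀ x → x ∈ A → Fin n) →
  (∀ x (x∈A : x ∈ A) → f x x∈A ∈ B) →
  (∀ x y (x∈A : x ∈ A) (y∈A : y ∈ A) → f x x∈A ≡ f y y∈A → x ≡ y) →
  ∣ A ∣ ≤ ∣ B ∣
injection⇒∣A∣≤∣B∣ zero    A B ∣A∣≡0 f maps inj = subst (_≤ ∣ B ∣) (sym ∣A∣≡0) z≤n
injection⇒∣A∣≤∣B∣ {n} (suc k) A B ∣A∣≡suc f maps inj
  with ∣p∣≡suc⇒nonempty A ∣A∣≡suc
... | x , x∈A
  rewrite ∣p∣≡suc∣p-x∣ x∈A | ∣p∣≡suc∣p-x∣ (maps x x∈A) =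
  s≤s (injection⇒∣A∣≤∣B∣ k (A - x) (B - f x x∈A) (suc-injective ∣A∣≡suc) f′ maps′ inj′)
  where
  f′ : ∀ y → y ∈ A - x → Fin n
  f′ y y∈A-x = f y (proj₁ (x∈p-y⁻ A y∈A-x))
  maps′ : ∀ y (y∈A-x : y ∈ A - x) → f′ y y∈A-x ∈ B - f x x∈A
  maps′ y y∈A-x = x∈p∧x≢y⇒x∈p-y (maps y _) (λ fy≡fx → proj₂ (x∈p-y⁻ A y∈A-x) (inj y x _ x∈A fy≡fx))
  inj′ : ∀ y w (y∈ : y ∈ A - x) (w∈ : w ∈ A - x) → f′ y y∈ ≡ f′ w w∈ → y ≡ w
  inj′ y w _ _ = inj y w _ _

two-distinct-points : ∀ {n k} (B : Subset n) → ∣ B ∣ ≡ suc (suc k) →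
                      Σ (Fin n) λ x → Σ (Fin n) λ y → x ∈ B × y ∈ B × x ≢ y
two-distinct-points B ∣B∣≡ with ∣p∣≡suc⇒nonempty B ∣B∣≡
... | x , x∈B with ∣p∣≡suc⇒nonempty (B - x) (suc-injective (trans (sym (∣p∣≡suc∣p-x∣ x∈B)) ∣B∣≡))
... | y , y∈B-x = x , y , x∈B , proj₁ (x∈p-y⁻ B y∈B-x) , λ x≡y → proj₂ (x∈p-y⁻ B y∈B-x) (sym x≡y)

module _ {n : ℕ} {B : Subset n} (∣B∣≡3 : ∣ B ∣ ≡ 3) {x y : Fin n}
         (x∈B : x ∈ B) (y∈B : y ∈ B) (x≢y : x ≢ y) where

  private
    ∣B-x-y∣≡1 : ∣ B - x - y ∣ ≡ 1
    ∣B-x-y∣≡1 = suc-injective (trans (sym (∣p∣≡suc∣p-x∣ y∈B-x))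
                                     (suc-injective (trans (sym (∣p∣≡suc∣p-x∣ x∈B)) ∣B∣≡3)))
      where y∈B-x = x∈p∧x≢y⇒x∈p-y y∈B (λ y≡x → x≢y (sym y≡x))

  third-point : Σ (Fin n) λ t → t ∈ B × t ≢ x × t ≢ y
  third-point with ∣p∣≡suc⇒nonempty (B - x - y) ∣B-x-y∣≡1
  ... | t , t∈B-x-y with x∈p-y⁻ (B - x) t∈B-x-y
  ... | t∈B-x , t≢y with x∈p-y⁻ B t∈B-x
  ... | t∈B , t≢x = t , t∈B , t≢x , t≢y

  third-point-unique : ∀ {u v} → u ∈ B → u ≢ x → u ≢ y → v ∈ B → v ≢ x → v ≢ y → u ≡ v
  third-point-unique u∈B u≢x u≢y v∈B v≢x v≢y =
    ∣p∣≡1⇒unique ∣B-x-y∣≡1 (x∈p∧x≢y⇒x∈p-y (x∈p∧x≢y⇒x∈p-y u∈B u≢x) u≢y)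
                           (x∈p∧x≢y⇒x∈p-y (x∈p∧x≢y⇒x∈p-y v∈B v≢x) v≢y)

module _ {n : ℕ} {𝒜 : Family n} (psts : IsPSTS 𝒜) where
  open IsPSTS psts

  block-through : ∀ {S 𝒯} → IsSubsystem 𝒜 S 𝒯 → ∀ {x y} → x ∈ S → y ∈ S → x ≢ y →
                  Σ (Subset n) λ B → 𝒯 B × x ∈ B × y ∈ B
  block-through sys x∈S y∈S x≢y = proj₁ unique , proj₁ (proj₂ unique)
    where unique = IsSubsystem.exactlyOne sys _ _ x∈S y∈S x≢y

  -- A block of 𝒜 meeting the point set of a subsystem in two points is a
  -- block of that subsystem: it coincides with the subsystem's block
  -- through those two points.
  block-of-subsystem : ∀ {S 𝒯} → IsSubsystem 𝒜 S 𝒯 → ∀ {B x y} → 𝒜 B →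
                       x ∈ B → y ∈ B → x ≢ y → x ∈ S → y ∈ S → 𝒯 B
  block-of-subsystem sys {B} {x} {y} 𝒜B x∈B y∈B x≢y x∈S y∈S
    with block-through sys x∈S y∈S x≢y
  ... | B′ , 𝒯B′ , x∈B′ , y∈B′
    with refl ← pairOnce x y x≢y B B′ 𝒜B (IsSubsystem.sub sys B′ 𝒯B′) x∈B y∈B x∈B′ y∈B′
    = 𝒯B′

  blocks-inherited : ∀ {S S′ 𝒯 𝒯′} → IsSubsystem 𝒜 S 𝒯 → IsSubsystem 𝒜 S′ 𝒯′ →
                     S ⊆ S′ → ∀ B → 𝒯 B → 𝒯′ B
  blocks-inherited sys sys′ S⊆S′ B 𝒯B
    with two-distinct-points B (triple B (IsSubsystem.sub sys B 𝒯B))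
  ... | x , y , x∈B , y∈B , x≢y =
    block-of-subsystem sys′ (sub B 𝒯B) x∈B y∈B x≢y (S⊆S′ (block⊆S B 𝒯B x∈B)) (S⊆S′ (block⊆S B 𝒯B y∈B))
    where open IsSubsystem sys renaming (inside to block⊆S)

  module _ {S S′ : Subset n} {𝒯 𝒯′ : Family n}
           (sys : IsSubsystem 𝒜 S 𝒯) (sys′ : IsSubsystem 𝒜 S′ 𝒯′)
           {z : Fin n} (z∈S : z ∈ S) (z∉S′ : z ∉ S′) where
    open IsSubsystem sys using (sub) renaming (inside to block⊆S)

    W : Subset n
    W = S ∩ S′

    ≢z : ∀ {w} → w ∈ W → w ≢ z
    ≢z w∈W refl = z∉S′ (proj₂ (x∈p∩q⁻ S S′ w∈W))

    record Line (w : Fin n) : Set where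
      field
        block      : Subset n
        block∈𝒯    : 𝒯 block
        w∈block    : w ∈ block
        z∈block    : z ∈ block
        third      : Fin n
        third∈block : third ∈ block
        third≢w    : third ≢ w
        third≢z    : third ≢ z

    line : ∀ w → w ∈ W → Line w
    line w w∈W with block-through sys (proj₁ (x∈p∩q⁻ S S′ w∈W)) z∈S (≢z w∈W)
    ... | B , 𝒯B , w∈B , z∈B with third-point (triple B (sub B 𝒯B)) w∈B z∈B (≢z w∈W)
    ... | c , c∈B , c≢w , c≢z = record
      { block = B ; block∈𝒯 = 𝒯B ; w∈block = w∈B ; z∈block = z∈B
      ; third = c ; third∈block = c∈B ; third≢w = c≢w ; third≢z = c≢z }

    t : ∀ w → w ∈ W → Fin n
    t w w∈W = Line.third (line w w∈W)

    -- t(w) ∉ S′: otherwise the 𝒯′-block through t(w) and w is the 𝒯-block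
    -- through w and z, so z ∈ S′.
    t∉S′ : ∀ w (w∈W : w ∈ W) → t w w∈W ∉ S′
    t∉S′ w w∈W t∈S′ =
      z∉S′ (IsSubsystem.inside sys′ block 𝒯′block z∈block)
      where
      open Line (line w w∈W)
      𝒯′block = block-of-subsystem sys′ (sub block block∈𝒯) third∈block w∈block third≢w
                  t∈S′ (proj₂ (x∈p∩q⁻ S S′ w∈W))

    t∈S─S′-z : ∀ w (w∈W : w ∈ W) → t w w∈W ∈ (S ─ S′) - z
    t∈S─S′-z w w∈W = x∈p∧x≢y⇒x∈p-y (x∈p∧x∉q⇒x∈p─q (block⊆S block block∈𝒯 third∈block) (t∉S′ w w∈W)) third≢z
      where open Line (line w w∈W)

    -- t is injective: the blocks of x and y share z and t(x) = t(y), hence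
    -- coincide, and then x and y are both the third point besides z and t.
    t-injective : ∀ x y (x∈W : x ∈ W) (y∈W : y ∈ W) → t x x∈W ≡ t y y∈W → x ≡ y
    t-injective x y x∈W y∈W tx≡ty =
      third-point-unique (triple _ (sub _ Lx.block∈𝒯)) Lx.z∈block Lx.third∈block z≢t
        Lx.w∈block (≢z x∈W) (λ x≡t → Lx.third≢w (sym x≡t))
        y∈Bx (≢z y∈W) (λ y≡t → Ly.third≢w (trans (sym tx≡ty) (sym y≡t)))
      where
      module Lx = Line (line x x∈W)
      module Ly = Line (line y y∈W)
      z≢t : z ≢ Lx.third
      z≢t z≡t = Lx.third≢z (sym z≡t)
      same-block : Lx.block ≡ Ly.block
      same-block = pairOnce z Lx.third z≢t Lx.block Ly.block (sub _ Lx.block∈𝒯) (sub _ Ly.block∈𝒯)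
                     Lx.z∈block Lx.third∈block Ly.z∈block (subst (_∈ Ly.block) (sym tx≡ty) Ly.third∈block)
      y∈Bx : y ∈ Lx.block
      y∈Bx = subst (y ∈_) (sym same-block) Ly.w∈block

    -- S contains the disjoint pieces W, {z} and t(W).
    outside-point-bound : 2 * ∣ W ∣ < ∣ S ∣
    outside-point-bound = begin-strict
      2 * ∣ W ∣                    ≡⟨ cong (∣ W ∣ +_) (+-identityʳ ∣ W ∣) ⟩
      ∣ W ∣ + ∣ W ∣                 <⟨ +-monoʳ-< ∣ W ∣ (s≤s ∣W∣≤∣S─S′-z∣) ⟩
      ∣ W ∣ + suc ∣ (S ─ S′) - z ∣  ≡⟨ cong (∣ W ∣ +_) (sym (∣p∣≡suc∣p-x∣ z∈S─S′)) ⟩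
      ∣ W ∣ + ∣ S ─ S′ ∣            ≡⟨ sym (∣p∣≡∣p∩q∣+∣p─q∣ S S′) ⟩
      ∣ S ∣                        ∎
      where
      open ≤-Reasoning
      z∈S─S′ = x∈p∧x∉q⇒x∈p─q z∈S z∉S′
      ∣W∣≤∣S─S′-z∣ = injection⇒∣A∣≤∣B∣ _ W ((S ─ S′) - z) refl t t∈S─S′-z t-injective

  small-subsystem-⊆ : ∀ {R S S′ 𝒯 𝒯′} →
                      IsSubsystem 𝒜 S 𝒯 → R ⊆ S → ∣ S ∣ ≤ 2 * ∣ R ∣ →
                      IsSubsystem 𝒜 S′ 𝒯′ → R ⊆ S′ → S ⊆ S′
  small-subsystem-⊆ {R} {S} {S′} sys R⊆S ∣S∣≤2∣R∣ sys′ R⊆S′ {x} x∈S with x ∈? S′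
  ... | yes x∈S′ = x∈S′
  ... | no  x∉S′ = ⊥-elim (<-irrefl refl (begin-strict
      2 * ∣ R ∣      ≤⟨ *-monoʳ-≤ 2 (p⊆q⇒∣p∣≤∣q∣ (λ r∈R → x∈p∩q⁺ (R⊆S r∈R , R⊆S′ r∈R))) ⟩
      2 * ∣ S ∩ S′ ∣ <⟨ outside-point-bound sys sys′ x∈S x∉S′ ⟩
      ∣ S ∣          ≤⟨ ∣S∣≤2∣R∣ ⟩
      2 * ∣ R ∣      ∎))
    where open ≤-Reasoning

lemma7 : ∀ {n : ℕ} (𝒜 : Family n) → IsPSTS 𝒜 → (R : Subset n) →
    ∀ (S S′ : Subset n) (𝒯 𝒯′ : Family n) →
    IsSubsystem 𝒜 S 𝒯 → R ⊆ S → ∣ S ∣ ≤ 2 * ∣ R ∣ →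
    IsSubsystem 𝒜 S′ 𝒯′ → R ⊆ S′ → ∣ S′ ∣ ≤ 2 * ∣ R ∣ →
    S ≡ S′ × (∀ B → 𝒯 B ⇔ 𝒯′ B)
lemma7 𝒜 psts R S S′ 𝒯 𝒯′ sys R⊆S ∣S∣≤ sys′ R⊆S′ ∣S′∣≤ =
  ⊆-antisym S⊆S′ S′⊆S ,
  λ B → mk⇔ (blocks-inherited psts sys sys′ S⊆S′ B) (blocks-inherited psts sys′ sys S′⊆S B)
  where
  S⊆S′ = small-subsystem-⊆ psts sys R⊆S ∣S∣≤ sys′ R⊆S′
  S′⊆S = small-subsystem-⊆ psts sys′ R⊆S′ ∣S′∣≤ sys R⊆S
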